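{- For a graph $G$ with no isolated vertex, $\gamma_{(2,2,1)}(G)=3$ if and only if $\gamma(G)=1$ or $\gamma_{\times2,t}(G)=3$.
   Context: All graphs are finite and simple; $N(v)$ is the open neighbourhood and $f(S)=\sum_{u\in S}f(u)$. $\gamma_{(2,2,1)}(G)$ is the minimum of $\sum_v f(v)$ over functions $f:V(G)\to\{0,1,2\}$ such that $f(N(v))\ge2$ whenever $f(v)\in\{0,1\}$ and $f(N(v))\ge1$ whenever $f(v)=2$. $\gamma(G)$ is the domination number; $\gamma_{\times2,t}(G)$ is the double total domination number (minimum size of a set $D$ such that every vertex has at least two neighbours in $D$), defined for graphs of minimum degree at least $2$. -}

module Defs where

open import Data.Nat using (ℕ; zero; suc; _+_; _≤_)
open import Data.Bool using (Bool; true; false; if_then_else_)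
open import Data.Fin using (Fin; zero; suc; toℕ)
open import Data.Fin.Subset using (Subset; _∈_; _∩_; ∣_∣)
open import Data.Vec using (tabulate)
open import Data.Product using (Σ; ∃; _×_; _,_)
open import Data.Sum using (_⊎_)
open import Relation.Binary.PropositionalEquality using (_≡_)

record Graph : Set where
  field
    n      : ℕ
    adj    : Fin n → Fin n → Bool
    sym    : ∀ u v → adj u v ≡ adj v u
    irrefl : ∀ v → adj v v ≡ false
open Graph public

sumFin : ∀ {n} → (Fin n → ℕ) → ℕ
sumFin {zero}  f = 0
sumFin {suc n} f = f zero + sumFin (λ i → f (suc i))

module _ (G : Graph) where

  N : Fin (n G) → Subset (n G)
  N v = tabulate (adj G v)

  NoIsolatedVertex : Set
  NoIsolatedVertex = ∀ v → ∃ λ u → adj G v u ≡ true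

  Labelling : Set
  Labelling = Fin (n G) → Fin 3

  weightOn : Labelling → Subset (n G) → ℕ
  weightOn f S = sumFin (λ u → if Data.Vec.lookup S u then toℕ (f u) else 0)

  weight : Labelling → ℕ
  weight f = sumFin (λ u → toℕ (f u))

  Is221DF : Labelling → Set
  Is221DF f = ∀ v → (toℕ (f v) ≡ 2 → 1 ≤ weightOn f (N v))
                  × (toℕ (f v) ≤ 1 → 2 ≤ weightOn f (N v))

  γ221≡ : ℕ → Set
  γ221≡ k = (Σ Labelling λ f → Is221DF f × weight f ≡ k)
          × (∀ f → Is221DF f → k ≤ weight f)

  IsDominating : Subset (n G) → Set
  IsDominating D = ∀ v → v ∈ D ⊎ (∃ λ u → u ∈ D × adj G v u ≡ true)

  γ≡ : ℕ → Set
  γ≡ k = (Σ (Subset (n G)) λ D → IsDominating D × ∣ D ∣ ≡ k)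
       × (∀ D → IsDominating D → k ≤ ∣ D ∣)

  IsDoubleTotalDominating : Subset (n G) → Set
  IsDoubleTotalDominating D = ∀ v → 2 ≤ ∣ D ∩ N v ∣

  γ×2t≡ : ℕ → Set
  γ×2t≡ k = (Σ (Subset (n G)) λ D → IsDoubleTotalDominating D × ∣ D ∣ ≡ k)
          × (∀ D → IsDoubleTotalDominating D → k ≤ ∣ D ∣)

module Submission where

-- Every (2,2,1)-dominating function f has weight at least 3: some vertex u has positive value, and
-- then f(u) + f(N(u)) ≥ min (2 + 1, 1 + 2).  If f has weight 3 and f(v) = 2, the other vertices carry
-- weight 1 in total, while f(N(w)) ≥ 2 for every w ≠ v; so v ∈ N(w), v is universal and γ = 1.
-- Otherwise f is 0/1-valued and its support is a double total dominating set of size 3, which is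
-- minimum because the indicator of any such set is a (2,2,1)-dominating function.  Conversely, a
-- universal vertex v with a neighbour u gives the function 2 at v, 1 at u, 0 elsewhere.

open import Defs hiding (sym)
open import Data.Sum using (_⊎_; inj₁; inj₂)
open import Data.Product using (_×_; _,_; ∃; proj₁; proj₂)
open import Data.Nat using (ℕ; zero; suc; _+_; _≤_; _≡ᵇ_; z≤n; s≤s)
open import Data.Nat.Properties
  using (≤-trans; ≤-reflexive; +-mono-≤; +-monoʳ-≤; +-cancelˡ-≤; +-cancelʳ-≤; m≤m+n; m≤n+m;
         +-identityʳ; 1+n≰n; +-commutativeSemigroup)
import Data.Nat as Nat
open import Algebra.Properties.CommutativeSemigroup +-commutativeSemigroup using (x∙yz≈y∙xz)
open import Data.Bool using (true; false; not; if_then_else_)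
open import Data.Fin using (Fin; zero; suc; toℕ; #_; _≟_; punchIn; punchOut)
open import Data.Fin.Properties using (any?; punchInᵢ≢i; punchIn-injective; punchIn-punchOut)
open import Data.Fin.Subset using (Subset; _∈_; _∉_; _∩_; ∣_∣; ⁅_⁆; _-_; Nonempty)
open import Data.Fin.Subset.Properties
  using (x∈⁅x⁆; x≢y⇒x∉⁅y⁆; ∣⁅x⁆∣≡1; nonempty?; Empty-unique; ∣⊥∣≡0; _∈?_;
         x∈p∧x≢y⇒x∈p-y; x∈p⇒∣p-x∣<∣p∣)
open import Data.Vec using (_∷_; []; lookup; tabulate)
open import Data.Vec.Properties using (lookup∘tabulate; []=⇒lookup; lookup⇒[]=)
open import Function using (_∘_)
open import Relation.Binary.PropositionalEquality
open import Relation.Nullary using (yes; no; does; contradiction)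
open import Relation.Nullary.Decidable using (dec-true; dec-false)

sumFin-cong : ∀ {m} {f g : Fin m → ℕ} → (∀ i → f i ≡ g i) → sumFin f ≡ sumFin g
sumFin-cong {zero}  f≗g = refl
sumFin-cong {suc m} f≗g = cong₂ _+_ (f≗g zero) (sumFin-cong (f≗g ∘ suc))

sumFin-mono : ∀ {m} {f g : Fin m → ℕ} → (∀ i → f i ≤ g i) → sumFin f ≤ sumFin g
sumFin-mono {zero}  f≤g = z≤n
sumFin-mono {suc m} f≤g = +-mono-≤ (f≤g zero) (sumFin-mono (f≤g ∘ suc))

sumFin-punchIn : ∀ {m} (g : Fin (suc m) → ℕ) i → sumFin g ≡ g i + sumFin (g ∘ punchIn i)
sumFin-punchIn         g zero    = refl
sumFin-punchIn {suc m} g (suc i) = begin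
  g zero + sumFin (g ∘ suc)                            ≡⟨ cong (g zero +_) (sumFin-punchIn (g ∘ suc) i) ⟩
  g zero + (g (suc i) + sumFin (g ∘ suc ∘ punchIn i))  ≡⟨ x∙yz≈y∙xz (g zero) (g (suc i)) _ ⟩
  g (suc i) + sumFin (g ∘ punchIn (suc i))             ∎
  where open ≡-Reasoning

sumFin-positive : ∀ {m} (g : Fin m → ℕ) → 1 ≤ sumFin g → ∃ λ i → 1 ≤ g i
sumFin-positive {suc m} g 1≤Σ with g zero in g0≡
... | zero  = let (i , 1≤gi) = sumFin-positive (g ∘ suc) 1≤Σ in suc i , 1≤gi
... | suc _ = zero , subst (1 ≤_) (sym g0≡) (s≤s z≤n)

sumFin-zero : ∀ {m} {g : Fin m → ℕ} → (∀ i → g i ≡ 0) → sumFin g ≡ 0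
sumFin-zero {zero}  g≗0 = refl
sumFin-zero {suc m} g≗0 = cong₂ _+_ (g≗0 zero) (sumFin-zero (g≗0 ∘ suc))

sumFin-single : ∀ {m} (g : Fin m → ℕ) i → (∀ j → j ≢ i → g j ≡ 0) → sumFin g ≡ g i
sumFin-single {suc m} g i vanish = begin
  sumFin g                          ≡⟨ sumFin-punchIn g i ⟩
  g i + sumFin (g ∘ punchIn i)      ≡⟨ cong (g i +_) (sumFin-zero (λ j → vanish _ (punchInᵢ≢i i j))) ⟩
  g i + 0                           ≡⟨ +-identityʳ (g i) ⟩
  g i                               ∎
  where open ≡-Reasoning

sumFin-pair : ∀ {m} (g : Fin m → ℕ) {i j} → i ≢ j → (∀ k → k ≢ i → k ≢ j → g k ≡ 0) →
              sumFin g ≡ g i + g j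
sumFin-pair {suc m} g {i} {j} i≢j vanish = begin
  sumFin g                                    ≡⟨ sumFin-punchIn g i ⟩
  g i + sumFin (g ∘ punchIn i)                ≡⟨ cong (g i +_) (sumFin-single (g ∘ punchIn i) j′ vanish′) ⟩
  g i + g (punchIn i j′)                      ≡⟨ cong (λ k → g i + g k) (punchIn-punchOut i≢j) ⟩
  g i + g j                                   ∎
  where
  open ≡-Reasoning
  j′ : Fin m
  j′ = punchOut i≢j
  vanish′ : ∀ k → k ≢ j′ → g (punchIn i k) ≡ 0
  vanish′ k k≢j′ = vanish (punchIn i k) (punchInᵢ≢i i k) λ ik≡j →
    k≢j′ (punchIn-injective i k j′ (trans ik≡j (sym (punchIn-punchOut i≢j))))

-- f(S) in the notation of the paper: weightOn G f S unfolds to sumOver S (λ u → toℕ (f u)).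
sumOver : ∀ {m} → Subset m → (Fin m → ℕ) → ℕ
sumOver S g = sumFin (λ u → if lookup S u then g u else 0)

sumOver-cong : ∀ {m} (S : Subset m) {g h : Fin m → ℕ} → (∀ i → g i ≡ h i) →
               sumOver S g ≡ sumOver S h
sumOver-cong S g≗h = sumFin-cong (λ u → cong (if lookup S u then_else 0) (g≗h u))

if-then-0-≤ : ∀ b n → (if b then n else 0) ≤ n
if-then-0-≤ true  n = ≤-reflexive refl
if-then-0-≤ false n = z≤n

∈⇒≤sumOver : ∀ {m} {S : Subset m} {u} (g : Fin m → ℕ) → u ∈ S → g u ≤ sumOver S g
∈⇒≤sumOver {suc m} {S} {u} g u∈S = begin
  g u                                  ≡⟨ cong (if_then g u else 0) ([]=⇒lookup u∈S) ⟨
  mask u                               ≤⟨ m≤m+n (mask u) _ ⟩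
  mask u + sumFin (mask ∘ punchIn u)   ≡⟨ sumFin-punchIn mask u ⟨
  sumOver S g                          ∎
  where
  open Data.Nat.Properties.≤-Reasoning
  mask : Fin (suc m) → ℕ
  mask x = if lookup S x then g x else 0

∉⇒+sumOver≤sumFin : ∀ {m} {S : Subset m} {v} (g : Fin m → ℕ) → v ∉ S → g v + sumOver S g ≤ sumFin g
∉⇒+sumOver≤sumFin {suc m} {S} {v} g v∉S = begin
  g v + sumOver S g                             ≡⟨ cong (g v +_) (sumFin-punchIn mask v) ⟩
  g v + (mask v + sumFin (mask ∘ punchIn v))    ≡⟨ cong (λ x → g v + (x + sumFin (mask ∘ punchIn v))) mask-v≡0 ⟩
  g v + sumFin (mask ∘ punchIn v)               ≤⟨ +-monoʳ-≤ (g v) (sumFin-mono (mask≤g ∘ punchIn v)) ⟩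
  g v + sumFin (g ∘ punchIn v)                  ≡⟨ sumFin-punchIn g v ⟨
  sumFin g                                      ∎
  where
  open Data.Nat.Properties.≤-Reasoning
  mask : Fin (suc m) → ℕ
  mask x = if lookup S x then g x else 0
  mask≤g : ∀ x → mask x ≤ g x
  mask≤g x = if-then-0-≤ (lookup S x) (g x)
  mask-v≡0 : mask v ≡ 0
  mask-v≡0 with lookup S v in v∈?S
  ... | true  = contradiction (lookup⇒[]= v S v∈?S) v∉S
  ... | false = refl

pair≤sumFin : ∀ {m} (g : Fin m → ℕ) {i j} → i ≢ j → g i + g j ≤ sumFin g
pair≤sumFin g {i} {j} i≢j =
  ≤-trans (+-monoʳ-≤ (g i) (∈⇒≤sumOver g (x∈⁅x⁆ j))) (∉⇒+sumOver≤sumFin g (x≢y⇒x∉⁅y⁆ i≢j))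

nonempty⇒1≤∣p∣ : ∀ {m} {p : Subset m} → Nonempty p → 1 ≤ ∣ p ∣
nonempty⇒1≤∣p∣ (x , x∈p) = ≤-trans (s≤s z≤n) (x∈p⇒∣p-x∣<∣p∣ x∈p)

1≤∣p∣⇒nonempty : ∀ {m} (p : Subset m) → 1 ≤ ∣ p ∣ → Nonempty p
1≤∣p∣⇒nonempty {m} p 1≤∣p∣ with nonempty? p
... | yes p≠∅ = p≠∅
... | no  p=∅ = contradiction (subst (1 ≤_) ∣p∣≡0 1≤∣p∣) λ ()
  where
  ∣p∣≡0 : ∣ p ∣ ≡ 0
  ∣p∣≡0 = trans (cong ∣_∣ (Empty-unique p=∅)) (∣⊥∣≡0 m)

∣p∣≡1⇒≡ : ∀ {m} {p : Subset m} {x y} → ∣ p ∣ ≡ 1 → x ∈ p → y ∈ p → x ≡ y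
∣p∣≡1⇒≡ {p = p} {x} {y} ∣p∣≡1 x∈p y∈p with x ≟ y
... | yes x≡y = x≡y
... | no  x≢y =
  contradiction (≤-trans (s≤s 1≤∣p-y∣) (subst (suc ∣ p - y ∣ ≤_) ∣p∣≡1 (x∈p⇒∣p-x∣<∣p∣ y∈p))) 1+n≰n
  where
  1≤∣p-y∣ : 1 ≤ ∣ p - y ∣
  1≤∣p-y∣ = nonempty⇒1≤∣p∣ (x , x∈p∧x≢y⇒x∈p-y x∈p x≢y)

toℕ≡2⊎toℕ≤1 : (a : Fin 3) → toℕ a ≡ 2 ⊎ toℕ a ≤ 1
toℕ≡2⊎toℕ≤1 zero             = inj₂ z≤n
toℕ≡2⊎toℕ≤1 (suc zero)       = inj₂ (s≤s z≤n)
toℕ≡2⊎toℕ≤1 (suc (suc zero)) = inj₁ refl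

indicator : ∀ {m} → Subset m → Fin m → Fin 3
indicator D x = if lookup D x then # 1 else # 0

toℕ-indicator≤1 : ∀ {m} (D : Subset m) x → toℕ (indicator D x) ≤ 1
toℕ-indicator≤1 D x with lookup D x
... | true  = s≤s z≤n
... | false = z≤n

sumFin-indicator : ∀ {m} (D : Subset m) → sumFin (λ x → toℕ (indicator D x)) ≡ ∣ D ∣
sumFin-indicator []          = refl
sumFin-indicator (true ∷ D)  = cong suc (sumFin-indicator D)
sumFin-indicator (false ∷ D) = sumFin-indicator D

sumOver-indicator : ∀ {m} (D S : Subset m) → sumOver S (λ x → toℕ (indicator D x)) ≡ ∣ D ∩ S ∣
sumOver-indicator []          []          = refl
sumOver-indicator (true ∷ D)  (true ∷ S)  = cong suc (sumOver-indicator D S)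
sumOver-indicator (true ∷ D)  (false ∷ S) = sumOver-indicator D S
sumOver-indicator (false ∷ D) (true ∷ S)  = sumOver-indicator D S
sumOver-indicator (false ∷ D) (false ∷ S) = sumOver-indicator D S

support : ∀ {m} → (Fin m → Fin 3) → Subset m
support f = tabulate (λ x → not (toℕ (f x) ≡ᵇ 0))

indicator-support : ∀ {m} (f : Fin m → Fin 3) → (∀ x → toℕ (f x) ≤ 1) →
                    ∀ x → f x ≡ indicator (support f) x
indicator-support f f≤1 x =
  trans (zeroOne (f x) (f≤1 x)) (cong (if_then # 1 else # 0) (sym (lookup∘tabulate _ x)))
  where
  zeroOne : (a : Fin 3) → toℕ a ≤ 1 → a ≡ (if not (toℕ a ≡ᵇ 0) then # 1 else # 0)
  zeroOne zero             _ = refl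
  zeroOne (suc zero)       _ = refl
  zeroOne (suc (suc zero)) (s≤s ())

star : ∀ {m} → Fin m → Fin m → Fin m → Fin 3
star c ℓ x = if does (x ≟ c) then # 2 else if does (x ≟ ℓ) then # 1 else # 0

star-centre : ∀ {m} (c ℓ : Fin m) → toℕ (star c ℓ c) ≡ 2
star-centre c ℓ rewrite dec-true (c ≟ c) refl = refl

star-leaf : ∀ {m} {c ℓ : Fin m} → ℓ ≢ c → toℕ (star c ℓ ℓ) ≡ 1
star-leaf {c = c} {ℓ} ℓ≢c rewrite dec-false (ℓ ≟ c) ℓ≢c | dec-true (ℓ ≟ ℓ) refl = refl

star-elsewhere : ∀ {m} {c ℓ x : Fin m} → x ≢ c → x ≢ ℓ → toℕ (star c ℓ x) ≡ 0
star-elsewhere {c = c} {ℓ} {x} x≢c x≢ℓ rewrite dec-false (x ≟ c) x≢c | dec-false (x ≟ ℓ) x≢ℓ = refl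

module _ (G : Graph) where

  adj⇒∈N : ∀ {v u} → adj G v u ≡ true → u ∈ N G v
  adj⇒∈N {v} {u} vu = lookup⇒[]= u (N G v) (trans (lookup∘tabulate (adj G v) u) vu)

  ∈N⇒adj : ∀ {v u} → u ∈ N G v → adj G v u ≡ true
  ∈N⇒adj {v} {u} u∈Nv = trans (sym (lookup∘tabulate (adj G v) u)) ([]=⇒lookup u∈Nv)

  v∉Nv : ∀ v → v ∉ N G v
  v∉Nv v v∈Nv with trans (sym (∈N⇒adj v∈Nv)) (irrefl G v)
  ... | ()

  adj⇒≢ : ∀ {v u} → adj G v u ≡ true → u ≢ v
  adj⇒≢ vu refl = v∉Nv _ (adj⇒∈N vu)

  closedNeighbourhood-weight≤ : ∀ f v → toℕ (f v) + weightOn G f (N G v) ≤ weight G f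
  closedNeighbourhood-weight≤ f v = ∉⇒+sumOver≤sumFin (λ u → toℕ (f u)) (v∉Nv v)

  module _ {f : Labelling G} (df : Is221DF G f) where

    neighbourhood-positive : ∀ v → 1 ≤ weightOn G f (N G v)
    neighbourhood-positive v with toℕ≡2⊎toℕ≤1 (f v)
    ... | inj₁ fv≡2 = proj₁ (df v) fv≡2
    ... | inj₂ fv≤1 = ≤-trans (s≤s z≤n) (proj₂ (df v) fv≤1)

    positive⇒weight≥3 : ∀ {v} → 1 ≤ toℕ (f v) → 3 ≤ weight G f
    positive⇒weight≥3 {v} 1≤fv = ≤-trans closed≥3 (closedNeighbourhood-weight≤ f v)
      where
      closed≥3 : 3 ≤ toℕ (f v) + weightOn G f (N G v)
      closed≥3 with toℕ≡2⊎toℕ≤1 (f v)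
      ... | inj₁ fv≡2 = +-mono-≤ (≤-reflexive (sym fv≡2)) (proj₁ (df v) fv≡2)
      ... | inj₂ fv≤1 = +-mono-≤ 1≤fv (proj₂ (df v) fv≤1)

    weight≥3 : Fin (n G) → 3 ≤ weight G f
    weight≥3 v = positive⇒weight≥3 (proj₂ (sumFin-positive (λ u → toℕ (f u)) 1≤weight))
      where
      1≤weight : 1 ≤ weight G f
      1≤weight = ≤-trans (neighbourhood-positive v)
                   (≤-trans (m≤n+m _ (toℕ (f v))) (closedNeighbourhood-weight≤ f v))

  γ221≡3-intro : ∀ {f} → Is221DF G f → weight G f ≡ 3 → γ221≡ G 3
  γ221≡3-intro {f} df weight≡3 = (f , df , weight≡3) , λ g dg → weight≥3 dg vertex
    where
    vertex : Fin (n G)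
    vertex = proj₁ (sumFin-positive (λ u → toℕ (f u)) (subst (1 ≤_) (sym weight≡3) (s≤s z≤n)))

  IsUniversal : Fin (n G) → Set
  IsUniversal v = ∀ w → w ≢ v → adj G w v ≡ true

  dominating⇒nonempty : ∀ {D} → IsDominating G D → Fin (n G) → Nonempty D
  dominating⇒nonempty dom v with dom v
  ... | inj₁ v∈D           = v , v∈D
  ... | inj₂ (u , u∈D , _) = u , u∈D

  universal⇒γ≡1 : ∀ {v} → IsUniversal v → γ≡ G 1
  universal⇒γ≡1 {v} universal =
    (⁅ v ⁆ , dominating , ∣⁅x⁆∣≡1 v) , λ D dom → nonempty⇒1≤∣p∣ (dominating⇒nonempty dom v)
    where
    dominating : IsDominating G ⁅ v ⁆
    dominating w with w ≟ v
    ... | yes refl = inj₁ (x∈⁅x⁆ w)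
    ... | no  w≢v  = inj₂ (v , x∈⁅x⁆ v , universal w w≢v)

  γ≡1⇒universal : γ≡ G 1 → ∃ IsUniversal
  γ≡1⇒universal ((D , dom , ∣D∣≡1) , _) with 1≤∣p∣⇒nonempty D (≤-reflexive (sym ∣D∣≡1))
  ... | v , v∈D = v , universal
    where
    universal : IsUniversal v
    universal w w≢v with dom w
    ... | inj₁ w∈D            = contradiction (∣p∣≡1⇒≡ ∣D∣≡1 w∈D v∈D) w≢v
    ... | inj₂ (u , u∈D , wu) = subst (λ x → adj G w x ≡ true) (∣p∣≡1⇒≡ ∣D∣≡1 u∈D v∈D) wu

  universal⇒γ221≡3 : NoIsolatedVertex G → ∀ {v} → IsUniversal v → γ221≡ G 3
  universal⇒γ221≡3 noIso {v} universal = γ221≡3-intro star-221DF star-weight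
    where
    u : Fin (n G)
    u = proj₁ (noIso v)
    u≢v : u ≢ v
    u≢v = adj⇒≢ (proj₂ (noIso v))
    F : Labelling G
    F = star v u
    neighbourhood≥2 : ∀ {w} → w ≢ v → 2 ≤ weightOn G F (N G w)
    neighbourhood≥2 w≢v =
      subst (_≤ weightOn G F (N G _)) (star-centre v u) (∈⇒≤sumOver _ (adj⇒∈N (universal _ w≢v)))
    neighbourhood≥1 : ∀ w → 1 ≤ weightOn G F (N G w)
    neighbourhood≥1 w with w ≟ v
    ... | yes refl =
      subst (_≤ weightOn G F (N G w)) (star-leaf u≢v) (∈⇒≤sumOver _ (adj⇒∈N (proj₂ (noIso w))))
    ... | no  w≢v  = ≤-trans (s≤s z≤n) (neighbourhood≥2 w≢v)
    star-221DF : Is221DF G F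
    star-221DF w = (λ _ → neighbourhood≥1 w)
                 , λ Fw≤1 → neighbourhood≥2 λ { refl → 1+n≰n (subst (_≤ 1) (star-centre v u) Fw≤1) }
    star-weight : weight G F ≡ 3
    star-weight = trans (sumFin-pair _ (u≢v ∘ sym) λ x x≢v x≢u → star-elsewhere x≢v x≢u)
                        (cong₂ _+_ (star-centre v u) (star-leaf u≢v))

  weight3⇒universal : ∀ {f} → Is221DF G f → weight G f ≡ 3 → ∀ {v} → toℕ (f v) ≡ 2 → IsUniversal v
  weight3⇒universal {f} df weight≡3 {v} fv≡2 w w≢v with v ∈? N G w
  ... | yes v∈Nw = ∈N⇒adj v∈Nw
  ... | no  v∉Nw = contradiction (≤-trans (proj₂ (df w) fw≤1) Nw≤1) 1+n≰n
    where
    g : Fin (n G) → ℕ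
    g x = toℕ (f x)
    fw≤1 : g w ≤ 1
    fw≤1 = +-cancelʳ-≤ 2 (g w) 1 (subst₂ (λ a b → g w + a ≤ b) fv≡2 weight≡3 (pair≤sumFin g w≢v))
    Nw≤1 : weightOn G f (N G w) ≤ 1
    Nw≤1 = +-cancelˡ-≤ 2 _ 1 (subst₂ (λ a b → a + weightOn G f (N G w) ≤ b) fv≡2 weight≡3
                                       (∉⇒+sumOver≤sumFin g v∉Nw))

  dtd⇒indicator-221DF : ∀ D → IsDoubleTotalDominating G D → Is221DF G (indicator D)
  dtd⇒indicator-221DF D dtd v =
      (λ ≡2 → contradiction (subst (_≤ 1) ≡2 (toℕ-indicator≤1 D v)) λ { (s≤s ()) })
    , λ _ → subst (2 ≤_) (sym (sumOver-indicator D (N G v))) (dtd v)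

  γ×2t≡3-intro : ∀ D → IsDoubleTotalDominating G D → ∣ D ∣ ≡ 3 → γ×2t≡ G 3
  γ×2t≡3-intro D dtd ∣D∣≡3 = (D , dtd , ∣D∣≡3) , minimal
    where
    vertex : Fin (n G)
    vertex = proj₁ (1≤∣p∣⇒nonempty D (subst (1 ≤_) (sym ∣D∣≡3) (s≤s z≤n)))
    minimal : ∀ D′ → IsDoubleTotalDominating G D′ → 3 ≤ ∣ D′ ∣
    minimal D′ dtd′ =
      subst (3 ≤_) (sumFin-indicator D′) (weight≥3 (dtd⇒indicator-221DF D′ dtd′) vertex)

  weight3⇒γ×2t≡3 : ∀ {f} → Is221DF G f → weight G f ≡ 3 → (∀ v → toℕ (f v) ≤ 1) → γ×2t≡ G 3
  weight3⇒γ×2t≡3 {f} df weight≡3 f≤1 = γ×2t≡3-intro D dtd (trans (sym weight≡∣D∣) weight≡3)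
    where
    D : Subset (n G)
    D = support f
    f≗indicator : ∀ x → toℕ (f x) ≡ toℕ (indicator D x)
    f≗indicator x = cong toℕ (indicator-support f f≤1 x)
    weight≡∣D∣ : weight G f ≡ ∣ D ∣
    weight≡∣D∣ = trans (sumFin-cong f≗indicator) (sumFin-indicator D)
    dtd : IsDoubleTotalDominating G D
    dtd v = subst (2 ≤_) (trans (sumOver-cong (N G v) f≗indicator) (sumOver-indicator D (N G v)))
                  (proj₂ (df v) (f≤1 v))

theorem3p22 : (G : Graph) → NoIsolatedVertex G →
    (γ221≡ G 3 → γ≡ G 1 ⊎ γ×2t≡ G 3) × (γ≡ G 1 ⊎ γ×2t≡ G 3 → γ221≡ G 3)
theorem3p22 G noIso = forward , backward
  where
  forward : γ221≡ G 3 → γ≡ G 1 ⊎ γ×2t≡ G 3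
  forward ((f , df , weight≡3) , _) with any? (λ v → toℕ (f v) Nat.≟ 2)
  ... | yes (v , fv≡2) = inj₁ (universal⇒γ≡1 G (weight3⇒universal G df weight≡3 fv≡2))
  ... | no  no-2       = inj₂ (weight3⇒γ×2t≡3 G df weight≡3 f≤1)
    where
    f≤1 : ∀ v → toℕ (f v) ≤ 1
    f≤1 v with toℕ≡2⊎toℕ≤1 (f v)
    ... | inj₁ fv≡2 = contradiction (v , fv≡2) no-2
    ... | inj₂ fv≤1 = fv≤1

  backward : γ≡ G 1 ⊎ γ×2t≡ G 3 → γ221≡ G 3
  backward (inj₁ γ≡1) = universal⇒γ221≡3 G noIso (proj₂ (γ≡1⇒universal G γ≡1))
  backward (inj₂ ((D , dtd , ∣D∣≡3) , _)) =
    γ221≡3-intro G (dtd⇒indicator-221DF G D dtd) (trans (sumFin-indicator D) ∣D∣≡3)
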